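{- Let $t$ be a term. For every extended context $\Gamma;s$, if $\Gamma;s\vdash t\ \mathrm{wf}$ then either $t$ is a normal form or there exists a term $t'$ with $t\mapsto t'$.
   Context: Terms: $t ::= x \mid \top \mid (\lambda x\leq t.u) \mid (u\,v)$, with $x$ from a countably infinite set of variables and $\top$ a constant; $x$ is bound in $u$ in $\lambda x\leq t.u$; terms identified up to renaming of bound variables; $\mathrm{fv}$ = free variables, $u[x:=v]$ = capture-avoiding substitution. $\mapsto$ is the least relation with $(\lambda x\leq t.u)\,v\mapsto u[x:=v]$ closed under all term contexts (if $t\mapsto t'$ then $\lambda x\leq t.u\mapsto\lambda x\leq t'.u$, $\lambda x\leq u.t\mapsto\lambda x\leq u.t'$, $t\,u\mapsto t'\,u$, $u\,t\mapsto u\,t'$). Normal forms are given by $t_n ::= \top \mid \lambda x\leq t_n.u_n \mid x\,t_{n,1}\cdots t_{n,k}$ ($k\ge 0$, all components normal forms). Extended context $\Gamma;s$: a finite sequence $\Gamma$ of annotations $x\leq t$ and a finite list (stack) $s$ of terms; $\varepsilon;[]$ empty, $\Gamma,x\leq t;s$ appends an annotation, $\Gamma;\alpha::s$ pushes $\alpha$. $\mathrm{dom}(\Gamma)$ = annotated variables; $x\leq t\in\Gamma$ means the annotation occurs in $\Gamma$; "$x$ has subtype $t$ in $\Gamma$" means $x\leq t$ is the last annotation for $x$ in $\Gamma$. Prevalidity: least predicate with $\varepsilon;[]$ prevalid; $\Gamma,x\leq t;[]$ prevalid if $\Gamma;[]$ prevalid, $x\notin\mathrm{dom}(\Gamma)$,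 $\mathrm{fv}(t)\subseteq\mathrm{dom}(\Gamma)$; $\Gamma;\alpha::s$ prevalid if $\Gamma;s$ prevalid and $\mathrm{fv}(\alpha)\subseteq\mathrm{dom}(\Gamma)$. Equivalence reduction $\to_{\equiv}$: least relation with $x\to_{\equiv}x$; $\top\to_{\equiv}\top$; $\top\,u\to_{\equiv}\top$; if $u\to_{\equiv}u'$, $v\to_{\equiv}v'$ then $u\,v\to_{\equiv}u'\,v'$ and $(\lambda x\leq t.u)\,v\to_{\equiv}u'[x:=v']$; if $t\to_{\equiv}t'$, $u\to_{\equiv}u'$ then $\lambda x\leq t.u\to_{\equiv}\lambda x\leq t'.u'$. Subtyping reduction $\Gamma;s\vdash u\to_{\leq}v$: least relation with (Prom) $\Gamma;s$ prevalid and $x\leq t\in\Gamma$ give $\Gamma;s\vdash x\to_{\leq}t$; (Top) $\Gamma;s$ prevalid gives $\Gamma;s\vdash u\to_{\leq}\top$; (Eq) $\Gamma;s$ prevalid and $u\to_{\equiv}v$ give $\Gamma;s\vdash u\to_{\leq}v$; (App) $\Gamma;v::s\vdash u\to_{\leq}u'$ gives $\Gamma;s\vdash u\,v\to_{\leq}u'\,v$; (FunOp) $\Gamma,x\leq\alpha;s\vdash u\to_{\leq}u'$ gives $\Gamma;\alpha::s\vdash\lambda x\leq t.u\to_{\leq}\lambda x\leq t.u'$; (Fun) $\Gamma,x\leq t;[]\vdash u\to_{\leq}u'$ gives $\Gamma;[]\vdash\lambda x\leq t.u\to_{\leq}\lambda x\leq t.u'$. Subtyping: $\Gamma;s\vdash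 v\leq t$ is the least relation with: if $\Gamma;s$ prevalid then $\Gamma;s\vdash t\leq t$; if $\Gamma;s\vdash v\to_{\leq}v'$ and $\Gamma;s\vdash v'\leq t$ then $\Gamma;s\vdash v\leq t$; if $\Gamma;s\vdash v\leq t'$ and $t\to_{\equiv}t'$ then $\Gamma;s\vdash v\leq t$. Well-formedness $\Gamma;s\vdash t\ \mathrm{wf}$, well-subtyping $\leq_{\mathrm{wf}}$ and transitive well-subtyping $\leq^*_{\mathrm{wf}}$ are the least relations (defined simultaneously) with: (W-Var) if $\Gamma;s$ prevalid, $x$ has subtype $t$ in $\Gamma$ and $\Gamma;s\vdash t\ \mathrm{wf}$ then $\Gamma;s\vdash x\ \mathrm{wf}$; (W-Top) if $\Gamma;s$ prevalid then $\Gamma;s\vdash\top\ \mathrm{wf}$; (W-Fun) if $\Gamma,x\leq t;[]\vdash u\ \mathrm{wf}$ and $\Gamma;[]\vdash t\ \mathrm{wf}$ then $\Gamma;[]\vdash\lambda x\leq t.u\ \mathrm{wf}$; (W-FunOp) if $\Gamma,x\leq\delta;s\vdash u\ \mathrm{wf}$ and $\Gamma;[]\vdash t\ \mathrm{wf}$ then $\Gamma;\delta::s\vdash\lambda x\leq t.u\ \mathrm{wf}$; (W-App) if $\Gamma;v::s\vdash u\leq^*_{\mathrm{wf}}\lambda x\leq t.\top$ and $\Gamma;[]\vdash v\leq^*_{\mathrm{wf}}t$ then $\Gamma;s\vdash u\,v\ \mathrm{wf}$; (Wf-Rule) if $\Gamma;s\vdash u\ \mathrm{wf}$, $\Gamma;s\vdash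 t\ \mathrm{wf}$ and $\Gamma;s\vdash u\leq t$ then $\Gamma;s\vdash u\leq_{\mathrm{wf}}t$; (Wf-Sub) $\Gamma;s\vdash v\leq_{\mathrm{wf}}t$ gives $\Gamma;s\vdash v\leq^*_{\mathrm{wf}}t$; (Wf-Trans) if $\Gamma;s\vdash v\leq^*_{\mathrm{wf}}u$, $\Gamma;s\vdash u\leq^*_{\mathrm{wf}}t$ and $\Gamma;s\vdash u\ \mathrm{wf}$ then $\Gamma;s\vdash v\leq^*_{\mathrm{wf}}t$. -}

module Defs where

-- Terms with de Bruijn indices (terms up to alpha-equivalence).
-- lam t u  represents  λ x ≤ t . u  (x = index 0 in u, not bound in t).

open import Data.Nat using (ℕ; zero; suc; _<_)
open import Data.List using (List; []; _∷_; length; map)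
open import Data.List.Relation.Unary.All using (All)
open import Data.Product using (_×_)
open import Data.Unit using (⊤)

data Term : Set where
  var : ℕ → Term
  top : Term
  lam : Term → Term → Term
  app : Term → Term → Term

ext : (ℕ → ℕ) → ℕ → ℕ
ext ρ zero    = zero
ext ρ (suc n) = suc (ρ n)

rename : (ℕ → ℕ) → Term → Term
rename ρ (var x)   = var (ρ x)
rename ρ top       = top
rename ρ (lam t u) = lam (rename ρ t) (rename (ext ρ) u)
rename ρ (app u v) = app (rename ρ u) (rename ρ v)

shift : Term → Term
shift = rename suc

exts : (ℕ → Term) → ℕ → Term
exts σ zero    = var zero
exts σ (suc n) = shift (σ n)

subst : (ℕ → Term) → Term → Term
subst σ (var x)   = σ x
subst σ top       = top
subst σ (lam t u) = lam (subst σ t) (subst (exts σ) u)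
subst σ (app u v) = app (subst σ u) (subst σ v)

sub0 : Term → ℕ → Term
sub0 v zero    = v
sub0 v (suc n) = var n

_[_] : Term → Term → Term
u [ v ] = subst (sub0 v) u

infix 4 _↦_
data _↦_ : Term → Term → Set where
  β     : ∀ {t u v} → app (lam t u) v ↦ u [ v ]
  lamₗ  : ∀ {t t' u} → t ↦ t' → lam t u ↦ lam t' u
  lamᵣ  : ∀ {t u u'} → u ↦ u' → lam t u ↦ lam t u'
  appₗ  : ∀ {t t' u} → t ↦ t' → app t u ↦ app t' u
  appᵣ  : ∀ {t u u'} → u ↦ u' → app t u ↦ app t u'

mutual
  data Neutral : Term → Set where
    nvar : ∀ {x} → Neutral (var x)
    napp : ∀ {u v} → Neutral u → NF v → Neutral (app u v)

  data NF : Term → Set where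
    ntop : NF top
    nlam : ∀ {t u} → NF t → NF u → NF (lam t u)
    nne  : ∀ {u} → Neutral u → NF u

Scoped : ℕ → Term → Set
Scoped n (var x)   = x < n
Scoped n top       = ⊤
Scoped n (lam t u) = Scoped n t × Scoped (suc n) u
Scoped n (app u v) = Scoped n u × Scoped n v

-- Contexts: list of annotations, most recent first (index 0 = last added).
-- Γ , x ≤ t  is  t ∷ Γ  (t lives in the scope of Γ).
Ctx : Set
Ctx = List Term

Stack : Set
Stack = List Term

data PrevalidCtx : Ctx → Set where
  pv-ε : PrevalidCtx []
  pv-, : ∀ {Γ t} → PrevalidCtx Γ → Scoped (length Γ) t → PrevalidCtx (t ∷ Γ)

Prevalid : Ctx → Stack → Set
Prevalid Γ s = PrevalidCtx Γ × All (Scoped (length Γ)) s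

-- x ≤ t ∈ Γ  (t expressed in the scope of the whole Γ).  Since prevalidity forbids
-- repeated variables, this is also "x has subtype t in Γ".
infix 4 _∋_≤_
data _∋_≤_ : Ctx → ℕ → Term → Set where
  here  : ∀ {Γ t} → (t ∷ Γ) ∋ zero ≤ shift t
  there : ∀ {Γ a x t} → Γ ∋ x ≤ t → (a ∷ Γ) ∋ suc x ≤ shift t

infix 4 _→≡_
data _→≡_ : Term → Term → Set where
  ≡var  : ∀ {x} → var x →≡ var x
  ≡top  : top →≡ top
  ≡topapp : ∀ {u} → app top u →≡ top
  ≡app  : ∀ {u u' v v'} → u →≡ u' → v →≡ v' → app u v →≡ app u' v'
  ≡β    : ∀ {t u u' v v'} → u →≡ u' → v →≡ v' → app (lam t u) v →≡ u' [ v' ]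
  ≡lam  : ∀ {t t' u u'} → t →≡ t' → u →≡ u' → lam t u →≡ lam t' u'

infix 3 _⨾_⊢_→≤_
data _⨾_⊢_→≤_ : Ctx → Stack → Term → Term → Set where
  Prom  : ∀ {Γ s x t} → Prevalid Γ s → Γ ∋ x ≤ t → Γ ⨾ s ⊢ var x →≤ t
  Top   : ∀ {Γ s u} → Prevalid Γ s → Γ ⨾ s ⊢ u →≤ top
  Eq    : ∀ {Γ s u v} → Prevalid Γ s → u →≡ v → Γ ⨾ s ⊢ u →≤ v
  App   : ∀ {Γ s u u' v} → Γ ⨾ (v ∷ s) ⊢ u →≤ u' → Γ ⨾ s ⊢ app u v →≤ app u' v
  FunOp : ∀ {Γ s α t u u'} → (α ∷ Γ) ⨾ map shift s ⊢ u →≤ u'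
        → Γ ⨾ (α ∷ s) ⊢ lam t u →≤ lam t u'
  Fun   : ∀ {Γ t u u'} → (t ∷ Γ) ⨾ [] ⊢ u →≤ u' → Γ ⨾ [] ⊢ lam t u →≤ lam t u'

infix 3 _⨾_⊢_≤_
data _⨾_⊢_≤_ : Ctx → Stack → Term → Term → Set where
  ≤refl : ∀ {Γ s t} → Prevalid Γ s → Γ ⨾ s ⊢ t ≤ t
  ≤step : ∀ {Γ s v v' t} → Γ ⨾ s ⊢ v →≤ v' → Γ ⨾ s ⊢ v' ≤ t → Γ ⨾ s ⊢ v ≤ t
  ≤eq   : ∀ {Γ s v t t'} → Γ ⨾ s ⊢ v ≤ t' → t →≡ t' → Γ ⨾ s ⊢ v ≤ t

infix 3 _⨾_⊢_wf _⨾_⊢_≤wf_ _⨾_⊢_≤*wf_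
mutual
  data _⨾_⊢_wf : Ctx → Stack → Term → Set where
    W-Var   : ∀ {Γ s x t} → Prevalid Γ s → Γ ∋ x ≤ t → Γ ⨾ s ⊢ t wf → Γ ⨾ s ⊢ var x wf
    W-Top   : ∀ {Γ s} → Prevalid Γ s → Γ ⨾ s ⊢ top wf
    W-Fun   : ∀ {Γ t u} → (t ∷ Γ) ⨾ [] ⊢ u wf → Γ ⨾ [] ⊢ t wf → Γ ⨾ [] ⊢ lam t u wf
    W-FunOp : ∀ {Γ s δ t u} → (δ ∷ Γ) ⨾ map shift s ⊢ u wf → Γ ⨾ [] ⊢ t wf
            → Γ ⨾ (δ ∷ s) ⊢ lam t u wf
    W-App   : ∀ {Γ s u v t} → Γ ⨾ (v ∷ s) ⊢ u ≤*wf lam t top → Γ ⨾ [] ⊢ v ≤*wf t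
            → Γ ⨾ s ⊢ app u v wf

  data _⨾_⊢_≤wf_ : Ctx → Stack → Term → Term → Set where
    Wf-Rule : ∀ {Γ s u t} → Γ ⨾ s ⊢ u wf → Γ ⨾ s ⊢ t wf → Γ ⨾ s ⊢ u ≤ t → Γ ⨾ s ⊢ u ≤wf t

  data _⨾_⊢_≤*wf_ : Ctx → Stack → Term → Term → Set where
    Wf-Sub   : ∀ {Γ s v t} → Γ ⨾ s ⊢ v ≤wf t → Γ ⨾ s ⊢ v ≤*wf t
    Wf-Trans : ∀ {Γ s v u t} → Γ ⨾ s ⊢ v ≤*wf u → Γ ⨾ s ⊢ u ≤*wf t → Γ ⨾ s ⊢ u wf
             → Γ ⨾ s ⊢ v ≤*wf t

-- Only an application u v with u and v normal needs an argument: there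
-- W-App gives u ≤ λx≤t.⊤, and u must not be ⊤.  The invariant separating
-- ⊤ from every λ is "reduces to ⊤" under parallel β-reduction extended by
-- the absorption rule ⊤ v ⇛ ⊤.  It is preserved by forward parallel steps
-- (Takahashi's complete development gives the triangle property) and
-- trivially by backward ones, so it is preserved by →≡ in both directions.
-- For a subtyping reduction performed under a stack s, the invariant is
-- read on the term applied to (an instance of a prefix of) s; the variable
-- introduced by FunOp with bound α is then instantiated by α itself, while
-- all other variables stay head-variable terms, which never reduce to ⊤.
module Submission where

open import Defs
open import Data.Empty using (⊥-elim)
open import Data.List using (List; []; _∷_; map)
open import Data.List.Relation.Binary.Prefix.Heterogeneous using (Prefix; []; _∷_)
open import Data.Nat using (ℕ; zero; suc)
open import Data.Product using (∃; _,_)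
open import Data.Sum using (_⊎_; inj₁; inj₂)
open import Function using (id; _∘_)
open import Relation.Binary.Construct.Closure.ReflexiveTransitive using (Star; ε; _◅_)
open import Relation.Binary.PropositionalEquality
  using (_≡_; _≗_; refl; sym; trans; cong; cong₂; module ≡-Reasoning)
  renaming (subst to ≡-subst)
open import Relation.Nullary using (¬_)

open ≡-Reasoning

ext-cong : ∀ {ρ ρ'} → ρ ≗ ρ' → ext ρ ≗ ext ρ'
ext-cong h zero    = refl
ext-cong h (suc n) = cong suc (h n)

rename-cong : ∀ {ρ ρ'} → ρ ≗ ρ' → rename ρ ≗ rename ρ'
rename-cong h (var x)   = cong var (h x)
rename-cong h top       = refl
rename-cong h (lam t u) = cong₂ lam (rename-cong h t) (rename-cong (ext-cong h) u)
rename-cong h (app u v) = cong₂ app (rename-cong h u) (rename-cong h v)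

exts-cong : ∀ {σ τ} → σ ≗ τ → exts σ ≗ exts τ
exts-cong h zero    = refl
exts-cong h (suc n) = cong shift (h n)

subst-cong : ∀ {σ τ} → σ ≗ τ → subst σ ≗ subst τ
subst-cong h (var x)   = h x
subst-cong h top       = refl
subst-cong h (lam t u) = cong₂ lam (subst-cong h t) (subst-cong (exts-cong h) u)
subst-cong h (app u v) = cong₂ app (subst-cong h u) (subst-cong h v)

ext-∘ : ∀ ρ ρ' → ext ρ ∘ ext ρ' ≗ ext (ρ ∘ ρ')
ext-∘ ρ ρ' zero    = refl
ext-∘ ρ ρ' (suc n) = refl

rename-rename : ∀ ρ ρ' → rename ρ ∘ rename ρ' ≗ rename (ρ ∘ ρ')
rename-rename ρ ρ' (var x)   = refl
rename-rename ρ ρ' top       = refl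
rename-rename ρ ρ' (lam t u) =
  cong₂ lam (rename-rename ρ ρ' t)
            (trans (rename-rename (ext ρ) (ext ρ') u) (rename-cong (ext-∘ ρ ρ') u))
rename-rename ρ ρ' (app u v) = cong₂ app (rename-rename ρ ρ' u) (rename-rename ρ ρ' v)

exts-ext : ∀ σ ρ → exts σ ∘ ext ρ ≗ exts (σ ∘ ρ)
exts-ext σ ρ zero    = refl
exts-ext σ ρ (suc n) = refl

subst-rename : ∀ σ ρ → subst σ ∘ rename ρ ≗ subst (σ ∘ ρ)
subst-rename σ ρ (var x)   = refl
subst-rename σ ρ top       = refl
subst-rename σ ρ (lam t u) =
  cong₂ lam (subst-rename σ ρ t)
            (trans (subst-rename (exts σ) (ext ρ) u) (subst-cong (exts-ext σ ρ) u))
subst-rename σ ρ (app u v) = cong₂ app (subst-rename σ ρ u) (subst-rename σ ρ v)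

rename-exts : ∀ ρ σ → rename (ext ρ) ∘ exts σ ≗ exts (rename ρ ∘ σ)
rename-exts ρ σ zero    = refl
rename-exts ρ σ (suc n) =
  trans (rename-rename (ext ρ) suc (σ n)) (sym (rename-rename suc ρ (σ n)))

rename-subst : ∀ ρ σ → rename ρ ∘ subst σ ≗ subst (rename ρ ∘ σ)
rename-subst ρ σ (var x)   = refl
rename-subst ρ σ top       = refl
rename-subst ρ σ (lam t u) =
  cong₂ lam (rename-subst ρ σ t)
            (trans (rename-subst (ext ρ) (exts σ) u) (subst-cong (rename-exts ρ σ) u))
rename-subst ρ σ (app u v) = cong₂ app (rename-subst ρ σ u) (rename-subst ρ σ v)

subst-exts : ∀ σ τ → subst (exts σ) ∘ exts τ ≗ exts (subst σ ∘ τ)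
subst-exts σ τ zero    = refl
subst-exts σ τ (suc n) =
  trans (subst-rename (exts σ) suc (τ n)) (sym (rename-subst suc σ (τ n)))

subst-subst : ∀ σ τ → subst σ ∘ subst τ ≗ subst (subst σ ∘ τ)
subst-subst σ τ (var x)   = refl
subst-subst σ τ top       = refl
subst-subst σ τ (lam t u) =
  cong₂ lam (subst-subst σ τ t)
            (trans (subst-subst (exts σ) (exts τ) u) (subst-cong (subst-exts σ τ) u))
subst-subst σ τ (app u v) = cong₂ app (subst-subst σ τ u) (subst-subst σ τ v)

exts-var : exts var ≗ var
exts-var zero    = refl
exts-var (suc n) = refl

subst-id : subst var ≗ id
subst-id (var x)   = refl
subst-id top       = refl
subst-id (lam t u) = cong₂ lam (subst-id t) (trans (subst-cong exts-var u) (subst-id u))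
subst-id (app u v) = cong₂ app (subst-id u) (subst-id v)

infixr 5 _∷ˢ_
_∷ˢ_ : Term → (ℕ → Term) → ℕ → Term
(a ∷ˢ σ) zero    = a
(a ∷ˢ σ) (suc n) = σ n

subst-∷ˢ-shift : ∀ a σ → subst (a ∷ˢ σ) ∘ shift ≗ subst σ
subst-∷ˢ-shift a σ = subst-rename (a ∷ˢ σ) suc

sub0-exts : ∀ a σ → subst (sub0 a) ∘ exts σ ≗ a ∷ˢ σ
sub0-exts a σ zero    = refl
sub0-exts a σ (suc n) = trans (subst-rename (sub0 a) suc (σ n)) (subst-id (σ n))

subst-exts-[] : ∀ σ u a → subst (exts σ) u [ a ] ≡ subst (a ∷ˢ σ) u
subst-exts-[] σ u a = trans (subst-subst (sub0 a) (exts σ) u) (subst-cong (sub0-exts a σ) u)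

subst-[] : ∀ σ u v → subst σ (u [ v ]) ≡ subst (exts σ) u [ subst σ v ]
subst-[] σ u v = begin
  subst σ (u [ v ])                  ≡⟨ subst-subst σ (sub0 v) u ⟩
  subst (subst σ ∘ sub0 v) u         ≡⟨ subst-cong (λ { zero → refl ; (suc n) → refl }) u ⟩
  subst (subst σ v ∷ˢ σ) u           ≡⟨ sym (subst-exts-[] σ u (subst σ v)) ⟩
  subst (exts σ) u [ subst σ v ]     ∎

rename-[] : ∀ ρ u v → rename ρ (u [ v ]) ≡ rename (ext ρ) u [ rename ρ v ]
rename-[] ρ u v = begin
  rename ρ (u [ v ])                    ≡⟨ rename-subst ρ (sub0 v) u ⟩
  subst (rename ρ ∘ sub0 v) u           ≡⟨ subst-cong (λ { zero → refl ; (suc n) → refl }) u ⟩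
  subst (sub0 (rename ρ v) ∘ ext ρ) u   ≡⟨ sym (subst-rename (sub0 (rename ρ v)) (ext ρ) u) ⟩
  rename (ext ρ) u [ rename ρ v ]       ∎

infix 4 _⇛_ _⇛*_
data _⇛_ : Term → Term → Set where
  pvar    : ∀ {x} → var x ⇛ var x
  ptop    : top ⇛ top
  plam    : ∀ {t t' u u'} → t ⇛ t' → u ⇛ u' → lam t u ⇛ lam t' u'
  papp    : ∀ {u u' v v'} → u ⇛ u' → v ⇛ v' → app u v ⇛ app u' v'
  pβ      : ∀ {t u u' v v'} → u ⇛ u' → v ⇛ v' → app (lam t u) v ⇛ u' [ v' ]
  ptopapp : ∀ {u v} → u ⇛ top → app u v ⇛ top

_⇛*_ : Term → Term → Set
_⇛*_ = Star _⇛_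

⇛-refl : ∀ u → u ⇛ u
⇛-refl (var x)   = pvar
⇛-refl top       = ptop
⇛-refl (lam t u) = plam (⇛-refl t) (⇛-refl u)
⇛-refl (app u v) = papp (⇛-refl u) (⇛-refl v)

→≡⇒⇛ : ∀ {u v} → u →≡ v → u ⇛ v
→≡⇒⇛ ≡var       = pvar
→≡⇒⇛ ≡top       = ptop
→≡⇒⇛ ≡topapp    = ptopapp ptop
→≡⇒⇛ (≡app a b) = papp (→≡⇒⇛ a) (→≡⇒⇛ b)
→≡⇒⇛ (≡β a b)   = pβ (→≡⇒⇛ a) (→≡⇒⇛ b)
→≡⇒⇛ (≡lam a b) = plam (→≡⇒⇛ a) (→≡⇒⇛ b)

⇛-rename : ∀ ρ {u u'} → u ⇛ u' → rename ρ u ⇛ rename ρ u'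
⇛-rename ρ pvar        = pvar
⇛-rename ρ ptop        = ptop
⇛-rename ρ (plam d e)  = plam (⇛-rename ρ d) (⇛-rename (ext ρ) e)
⇛-rename ρ (papp d e)  = papp (⇛-rename ρ d) (⇛-rename ρ e)
⇛-rename ρ (pβ {u' = u'} {v' = v'} d e)
  rewrite rename-[] ρ u' v' = pβ (⇛-rename (ext ρ) d) (⇛-rename ρ e)
⇛-rename ρ (ptopapp d) = ptopapp (⇛-rename ρ d)

⇛-exts : ∀ {σ τ} → (∀ n → σ n ⇛ τ n) → ∀ n → exts σ n ⇛ exts τ n
⇛-exts h zero    = pvar
⇛-exts h (suc n) = ⇛-rename suc (h n)

⇛-subst : ∀ {σ τ} → (∀ n → σ n ⇛ τ n) → ∀ {u u'} → u ⇛ u' → subst σ u ⇛ subst τ u'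
⇛-subst h (pvar {x})  = h x
⇛-subst h ptop        = ptop
⇛-subst h (plam d e)  = plam (⇛-subst h d) (⇛-subst (⇛-exts h) e)
⇛-subst h (papp d e)  = papp (⇛-subst h d) (⇛-subst h e)
⇛-subst {τ = τ} h (pβ {u' = u'} {v' = v'} d e)
  rewrite subst-[] τ u' v' = pβ (⇛-subst (⇛-exts h) d) (⇛-subst h e)
⇛-subst h (ptopapp d) = ptopapp (⇛-subst h d)

⇛-[] : ∀ {u u' v v'} → u ⇛ u' → v ⇛ v' → u [ v ] ⇛ u' [ v' ]
⇛-[] {v = v} {v' = v'} d e = ⇛-subst sub0-⇛ d
  where
  sub0-⇛ : ∀ n → sub0 v n ⇛ sub0 v' n
  sub0-⇛ zero    = e
  sub0-⇛ (suc n) = pvar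

app⊤ : Term → Term → Term
app⊤ top v = top
app⊤ w   v = app w v

develop : Term → Term
develop (var x)           = var x
develop top               = top
develop (lam t u)         = lam (develop t) (develop u)
develop (app (lam t u) v) = develop u [ develop v ]
develop (app u v)         = app⊤ (develop u) (develop v)

app-⇛-app⊤ : ∀ {w c v d} → w ⇛ c → v ⇛ d → app w v ⇛ app⊤ c d
app-⇛-app⊤ {c = top}     p q = ptopapp p
app-⇛-app⊤ {c = var x}   p q = papp p q
app-⇛-app⊤ {c = lam _ _} p q = papp p q
app-⇛-app⊤ {c = app _ _} p q = papp p q

top-⇛-app⊤ : ∀ {c d} → top ⇛ c → top ⇛ app⊤ c d
top-⇛-app⊤ ptop = ptop

⇛-develop : ∀ {x y} → x ⇛ y → y ⇛ develop x
⇛-develop pvar                             = pvar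
⇛-develop ptop                             = ptop
⇛-develop (plam d e)                       = plam (⇛-develop d) (⇛-develop e)
⇛-develop (papp {u = var x} d e)           = app-⇛-app⊤ (⇛-develop d) (⇛-develop e)
⇛-develop (papp {u = top} d e)             = app-⇛-app⊤ (⇛-develop d) (⇛-develop e)
⇛-develop (papp {u = lam t b} (plam _ d) e) = pβ (⇛-develop d) (⇛-develop e)
⇛-develop (papp {u = app a b} d e)         = app-⇛-app⊤ (⇛-develop d) (⇛-develop e)
⇛-develop (pβ d e)                         = ⇛-[] (⇛-develop d) (⇛-develop e)
⇛-develop (ptopapp {u = var x} ())
⇛-develop (ptopapp {u = lam t b} ())
⇛-develop (ptopapp {u = top} ptop)         = ptop
⇛-develop (ptopapp {u = app a b} d)        = top-⇛-app⊤ (⇛-develop d)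

⇛*top-resp-⇛ : ∀ {x y} → x ⇛ y → x ⇛* top → y ⇛* top
⇛*top-resp-⇛ ptop ε       = ε
⇛*top-resp-⇛ d    (e ◅ r) = ⇛-develop d ◅ ⇛*top-resp-⇛ (⇛-develop e) r

lam-¬⇛*top : ∀ {t u} → ¬ (lam t u ⇛* top)
lam-¬⇛*top (plam _ _ ◅ r) = lam-¬⇛*top r

data HeadVar : Term → Set where
  hvar : ∀ {x} → HeadVar (var x)
  happ : ∀ {u v} → HeadVar u → HeadVar (app u v)

headVar-⇛ : ∀ {x y} → HeadVar x → x ⇛ y → HeadVar y
headVar-⇛ hvar     pvar        = hvar
headVar-⇛ (happ h) (papp d e)  = happ (headVar-⇛ h d)
headVar-⇛ (happ h) (ptopapp d) with () ← headVar-⇛ h d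

headVar-¬⇛*top : ∀ {x} → HeadVar x → ¬ (x ⇛* top)
headVar-¬⇛*top h (d ◅ r) = headVar-¬⇛*top (headVar-⇛ h d) r

apps : Term → List Term → Term
apps u []      = u
apps u (v ∷ s) = apps (app u v) s

apps-⇛ : ∀ {u u'} s → u ⇛ u' → apps u s ⇛ apps u' s
apps-⇛ []      d = d
apps-⇛ (v ∷ s) d = apps-⇛ s (papp d (⇛-refl v))

apps-⇛top : ∀ {u} s → u ⇛ top → apps u s ⇛ top
apps-⇛top []      d = d
apps-⇛top (v ∷ s) d = apps-⇛top s (ptopapp d)

apps-headVar : ∀ {u} s → HeadVar u → HeadVar (apps u s)
apps-headVar []      h = h
apps-headVar (v ∷ s) h = apps-headVar s (happ h)

Admissible : Ctx → (ℕ → Term) → Set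
Admissible Γ σ = ∀ {x t} → Γ ∋ x ≤ t → σ x ≡ subst σ t ⊎ HeadVar (σ x)

admissible-var : ∀ {Γ} → Admissible Γ var
admissible-var _ = inj₂ hvar

admissible-∷ : ∀ {Γ σ} α → Admissible Γ σ → Admissible (α ∷ Γ) (subst σ α ∷ˢ σ)
admissible-∷ {σ = σ} α _ here = inj₁ (sym (subst-∷ˢ-shift _ σ α))
admissible-∷ {σ = σ} α adm (there {t = t} x≤t) with adm x≤t
... | inj₁ e = inj₁ (trans e (sym (subst-∷ˢ-shift _ σ t)))
... | inj₂ h = inj₂ h

InstancePrefix : (ℕ → Term) → List Term → Stack → Set
InstancePrefix σ = Prefix (λ a b → a ≡ subst σ b)

instancePrefix-shift : ∀ {σ as s} a → InstancePrefix σ as s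
                     → InstancePrefix (a ∷ˢ σ) as (map shift s)
instancePrefix-shift a []                   = []
instancePrefix-shift {σ} a (_∷_ {b = b} e p) =
  trans e (sym (subst-∷ˢ-shift a σ b)) ∷ instancePrefix-shift a p

β-∷ˢ : ∀ σ t u a → app (lam t (subst (exts σ) u)) a ⇛ subst (a ∷ˢ σ) u
β-∷ˢ σ t u a =
  ≡-subst (app (lam t (subst (exts σ) u)) a ⇛_) (subst-exts-[] σ u a)
          (pβ (⇛-refl (subst (exts σ) u)) (⇛-refl a))

→≤-resp-⇛*top-instance :
  ∀ {Γ s u u' σ as} → Γ ⨾ s ⊢ u →≤ u' → Admissible Γ σ → InstancePrefix σ as s
  → apps (subst σ u) as ⇛* top → apps (subst σ u') as ⇛* top
→≤-resp-⇛*top-instance {as = as} (Prom _ x≤t) adm _ r with adm x≤t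
... | inj₁ e = ≡-subst (λ w → apps w as ⇛* top) e r
... | inj₂ h = ⊥-elim (headVar-¬⇛*top (apps-headVar as h) r)
→≤-resp-⇛*top-instance {as = as} (Top _) _ _ r = apps-⇛top as ptop ◅ ε
→≤-resp-⇛*top-instance {σ = σ} {as} (Eq _ e) _ _ r =
  ⇛*top-resp-⇛ (apps-⇛ as (⇛-subst (⇛-refl ∘ σ) (→≡⇒⇛ e))) r
→≤-resp-⇛*top-instance (App d) adm p r = →≤-resp-⇛*top-instance d adm (refl ∷ p) r
→≤-resp-⇛*top-instance (FunOp _) _ [] r = ⊥-elim (lam-¬⇛*top r)
→≤-resp-⇛*top-instance {σ = σ}
  (FunOp {α = α} {t = t} {u = u} {u' = u'} d) adm (_∷_ {as = as} refl p) r =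
  apps-⇛ as (β-∷ˢ σ (subst σ t) u' a) ◅ r'
  where
  a : Term
  a = subst σ α
  r' : apps (subst (a ∷ˢ σ) u') as ⇛* top
  r' = →≤-resp-⇛*top-instance d (admissible-∷ α adm) (instancePrefix-shift a p)
         (⇛*top-resp-⇛ (apps-⇛ as (β-∷ˢ σ (subst σ t) u a)) r)
→≤-resp-⇛*top-instance (Fun _) _ [] r = ⊥-elim (lam-¬⇛*top r)

→≤-resp-⇛*top : ∀ {Γ s u u'} → Γ ⨾ s ⊢ u →≤ u' → u ⇛* top → u' ⇛* top
→≤-resp-⇛*top {u = u} {u'} d r =
  ≡-subst (_⇛* top) (subst-id u')
    (→≤-resp-⇛*top-instance d admissible-var [] (≡-subst (_⇛* top) (sym (subst-id u)) r))

≤-resp-⇛*top : ∀ {Γ s u t} → Γ ⨾ s ⊢ u ≤ t → u ⇛* top → t ⇛* top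
≤-resp-⇛*top (≤refl _)   r = r
≤-resp-⇛*top (≤step d q) r = ≤-resp-⇛*top q (→≤-resp-⇛*top d r)
≤-resp-⇛*top (≤eq q e)   r = →≡⇒⇛ e ◅ ≤-resp-⇛*top q r

≤*wf-resp-⇛*top : ∀ {Γ s u t} → Γ ⨾ s ⊢ u ≤*wf t → u ⇛* top → t ⇛* top
≤*wf-resp-⇛*top (Wf-Sub (Wf-Rule _ _ q)) r = ≤-resp-⇛*top q r
≤*wf-resp-⇛*top (Wf-Trans p q _)         r = ≤*wf-resp-⇛*top q (≤*wf-resp-⇛*top p r)

top≰*wf-lam : ∀ {Γ s t u} → ¬ (Γ ⨾ s ⊢ top ≤*wf lam t u)
top≰*wf-lam p = lam-¬⇛*top (≤*wf-resp-⇛*top p ε)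

≤*wf-wfˡ : ∀ {Γ s u t} → Γ ⨾ s ⊢ u ≤*wf t → Γ ⨾ s ⊢ u wf
≤*wf-wfˡ (Wf-Sub (Wf-Rule w _ _)) = w
≤*wf-wfˡ (Wf-Trans p _ _)         = ≤*wf-wfˡ p

Progress : Term → Set
Progress t = NF t ⊎ ∃ (λ t' → t ↦ t')

progress-lam : ∀ {t u} → Progress t → Progress u → Progress (lam t u)
progress-lam (inj₂ (_ , r)) _              = inj₂ (_ , lamₗ r)
progress-lam (inj₁ _)       (inj₂ (_ , r)) = inj₂ (_ , lamᵣ r)
progress-lam (inj₁ nt)      (inj₁ nu)      = inj₁ (nlam nt nu)

progress-app : ∀ {Γ s u v t} → Γ ⨾ v ∷ s ⊢ u ≤*wf lam t top
             → Progress u → Progress v → Progress (app u v)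
progress-app _  (inj₂ (_ , r))      _              = inj₂ (_ , appₗ r)
progress-app _  (inj₁ _)            (inj₂ (_ , r)) = inj₂ (_ , appᵣ r)
progress-app u≤ (inj₁ ntop)         (inj₁ _)       = ⊥-elim (top≰*wf-lam u≤)
progress-app _  (inj₁ (nlam _ _))   (inj₁ _)       = inj₂ (_ , β)
progress-app _  (inj₁ (nne nu))     (inj₁ nv)      = inj₁ (nne (napp nu nv))

theorem4p1 : (t : Term) (Γ : Ctx) (s : Stack) → Γ ⨾ s ⊢ t wf → NF t ⊎ ∃ (λ t' → t ↦ t')
theorem4p1 (var _)   _ _ _ = inj₁ (nne nvar)
theorem4p1 top       _ _ _ = inj₁ ntop
theorem4p1 (lam t u) Γ _ (W-Fun wu wt) =
  progress-lam (theorem4p1 t Γ [] wt) (theorem4p1 u (t ∷ Γ) [] wu)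
theorem4p1 (lam t u) Γ _ (W-FunOp {s = s} {δ = δ} wu wt) =
  progress-lam (theorem4p1 t Γ [] wt) (theorem4p1 u (δ ∷ Γ) (map shift s) wu)
theorem4p1 (app u v) Γ s (W-App u≤ v≤) =
  progress-app u≤ (theorem4p1 u Γ (v ∷ s) (≤*wf-wfˡ u≤)) (theorem4p1 v Γ [] (≤*wf-wfˡ v≤))
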